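{- Let $0<k<n$ be integers, $\vec\kappa=\langle\kappa_0\le\dots\le\kappa_n\rangle$ a weakly increasing tuple of cardinals, and $B\in[n+1]^{k+1}$. For $\vec y\in\prod_{i\in B}\kappa_i$ let $\vec y^\infty\in X(\vec\kappa)$ be the point with $y^\infty_i=y_i$ for $i\in B$ and $y^\infty_i=\infty$ for $i\notin B$. If $\vec f=(f_A)_{A\in[n+1]^{k+1}}$ is a $k$-coboundary for $\vec\kappa$, then the function $\vec y\mapsto f_B(\vec y^\infty)$, $\prod_{i\in B}\kappa_i\to\mathbb{Z}_2$, is a top coboundary for the tuple $\vec\kappa|_B=\langle\kappa_i:i\in B\rangle$. (Hence $\vec f\mapsto(\vec y\mapsto f_B(\vec y^\infty))$ induces a well-defined map $H^k(X(\vec\kappa)^-,\underline{\mathbb{Z}_2})\to H^k(X(\vec\kappa|_B)^-,\underline{\mathbb{Z}_2})$.)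
   Context: For a cardinal $\kappa$, $\alpha(\kappa)=\kappa\sqcup\{\infty\}$ is the one-point compactification of the discrete space $\kappa$. For a tuple $\vec\mu=\langle\mu_0,\dots,\mu_m\rangle$, $X(\vec\mu)=\prod_{i\le m}\alpha(\mu_i)$ (product topology), $X(\vec\mu)^-=X(\vec\mu)\setminus\{(\infty,\dots,\infty)\}$; for $A\subseteq\{0,\dots,m\}$, $\mathcal{D}_A(\vec\mu)=\{\vec x\in X(\vec\mu):x_i\neq\infty\ \forall i\in A\}$ and $\mathcal{C}_A(\vec\mu)$ is the set of continuous maps $\mathcal{D}_A(\vec\mu)\to\mathbb{Z}_2$ ($\mathbb{Z}_2$ discrete). $[m+1]^j$ denotes the $j$-element subsets of $\{0,\dots,m\}$. A $j$-cochain is $\vec f=(f_A)_{A\in[m+1]^{j+1}}$ with $f_A\in\mathcal{C}_A(\vec\mu)$; $(d\vec f)_{A'}=\sum_{i\in A'}f_{A'\setminus\{i\}}$ on $\mathcal{D}_{A'}$; a $j$-coboundary is $d\vec g$ for a $(j-1)$-cochain $\vec g$. This complex computes $H^\bullet(X(\vec\mu)^-,\underline{\mathbb{Z}_2})$ (sheaf cohomology with constant coefficients $\mathbb{Z}/2\mathbb{Z}$; Aoki). Top cocycles (degree $m$) are arbitrary functions $\prod_{i\le m}\mu_i\to\mathbb{Z}_2$, and such $f$ is a top coboundary iff $f=\sum_{i\le m}g_i|_{\prod_j\mu_j}$ with $g_i\in\mathcal{C}_{\{0,\dots,m\}\setminus\{i\}}(\vec\mu)$. -}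

module Defs where

open import Data.Nat using (ℕ; zero; suc)
open import Data.Fin using (Fin; zero; suc)
open import Data.Vec using (Vec; []; _∷_; lookup; replicate)
open import Data.Bool using (Bool; true; false; _xor_; T)
open import Data.Maybe using (Maybe; just; nothing)
open import Data.List using (List)
open import Data.List.Membership.Propositional using (_∈_)
open import Data.Unit using (⊤; tt)
open import Data.Empty using (⊥)
open import Data.Product using (Σ; Σ-syntax; proj₁)
open import Relation.Nullary using (¬_)
open import Relation.Binary.PropositionalEquality using (_≡_)

-- Z₂ is Bool with _xor_ as addition.
-- Coordinates are indexed by Fin N (N = m+1 in the paper's notation).
-- A "cardinal" κ_i is represented by a type κ i; α(κ) = Maybe κ with ∞ = nothing.

SubsetN : ℕ → Set
SubsetN N = Vec Bool N

card : ∀ {N} → SubsetN N → ℕ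
card [] = 0
card (true ∷ B) = suc (card B)
card (false ∷ B) = card B

full : ∀ N → SubsetN N
full N = replicate N true

del : ∀ {N} → SubsetN N → Fin N → SubsetN N
del (_ ∷ A) zero = false ∷ A
del (b ∷ A) (suc i) = b ∷ del A i

del-⊆ : ∀ {N} (A : SubsetN N) (i j : Fin N) → T (lookup (del A i) j) → T (lookup A j)
del-⊆ (true ∷ A) zero (suc j) p = p
del-⊆ (false ∷ A) zero (suc j) p = p
del-⊆ (b ∷ A) (suc i) zero p = p
del-⊆ (b ∷ A) (suc i) (suc j) p = del-⊆ A i j p

⨁ : ∀ {N} → (Fin N → Bool) → Bool
⨁ {zero} f = false
⨁ {suc N} f = f zero xor ⨁ (λ i → f (suc i))

X : ∀ {N} → (Fin N → Set) → Set
X {N} κ = (i : Fin N) → Maybe (κ i)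

IsFin : ∀ {S : Set} → Maybe S → Set
IsFin (just _) = ⊤
IsFin nothing = ⊥

record D {N} (κ : Fin N → Set) (A : SubsetN N) : Set where
  constructor pt[_,_]
  field
    pt : X κ
    .def : (i : Fin N) → T (lookup A i) → IsFin (pt i)
open D public

-- basic neighbourhoods in α(κ): {a} around a finite point a,
-- {∞} ∪ (κ ∖ L) (L a finite list) around ∞
NearC : ∀ {S : Set} → Maybe S → List S → Maybe S → Set
NearC (just a) L y = y ≡ just a
NearC nothing L nothing = ⊤
NearC nothing L (just b) = ¬ (b ∈ L)

Near : ∀ {N} {κ : Fin N → Set} → X κ → ((i : Fin N) → List (κ i)) → X κ → Set
Near {N} x L y = (i : Fin N) → NearC (x i) (L i) (y i)

-- continuity into the discrete space Z₂ (= local constancy), D_A with subspace topology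
Continuous : ∀ {N} (κ : Fin N → Set) (A : SubsetN N) → (D κ A → Bool) → Set
Continuous {N} κ A f =
  (x : D κ A) → Σ[ L ∈ ((i : Fin N) → List (κ i)) ]
    ((y : D κ A) → Near (pt x) L (pt y) → f y ≡ f x)

C : ∀ {N} (κ : Fin N → Set) (A : SubsetN N) → Set
C κ A = Σ (D κ A → Bool) (Continuous κ A)

restrict : ∀ {N} {κ : Fin N → Set} (A : SubsetN N) (i : Fin N) → D κ A → D κ (del A i)
restrict A i pt[ x , d ] = pt[ x , (λ j p → d j (del-⊆ A i j p)) ]

dcob : ∀ {N} {κ : Fin N → Set} → ((A : SubsetN N) → C κ A) → (A : SubsetN N) → D κ A → Bool
dcob g A x = ⨁ λ i → sel (lookup A i) (proj₁ (g (del A i)) (restrict A i x))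
  where
  sel : Bool → Bool → Bool
  sel true b = b
  sel false b = false

-- k-coboundary (k ≥ 1): a k-cochain (components f_A, |A| = k+1) of the form d g.
-- g ranges over families indexed by all subsets; only the components with |A| = k
-- are ever used, so this is the same as ranging over (k-1)-cochains.
IsCoboundary : ∀ {N} (κ : Fin N → Set) (k : ℕ) →
  ((A : SubsetN N) → card A ≡ suc k → C κ A) → Set
IsCoboundary {N} κ k f =
  Σ[ g ∈ ((A : SubsetN N) → C κ A) ]
    ((A : SubsetN N) (hA : card A ≡ suc k) (x : D κ A) → proj₁ (f A hA) x ≡ dcob g A x)

embed : ∀ {N} {μ : Fin N → Set} → ((i : Fin N) → μ i) → D μ (full N)
embed y = pt[ (λ i → just (y i)) , (λ _ _ → tt) ]

IsTopCoboundary : ∀ {N} (μ : Fin N → Set) → (((i : Fin N) → μ i) → Bool) → Set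
IsTopCoboundary {N} μ h =
  Σ[ g ∈ ((i : Fin N) → C μ (del (full N) i)) ]
    ((y : (i : Fin N) → μ i) → h y ≡ ⨁ (λ i → proj₁ (g i) (restrict (full N) i (embed y))))

enum : ∀ {N} (B : SubsetN N) → Fin (card B) → Fin N
enum (true ∷ B) zero = zero
enum (true ∷ B) (suc j) = suc (enum B j)
enum (false ∷ B) j = suc (enum B j)

restrictTuple : ∀ {N} (κ : Fin N → Set) (B : SubsetN N) → Fin (card B) → Set
restrictTuple κ B j = κ (enum B j)

extInf : ∀ {N} (κ : Fin N → Set) (B : SubsetN N) → ((j : Fin (card B)) → κ (enum B j)) → X κ
extInf κ (true ∷ B) y zero = just (y zero)
extInf κ (true ∷ B) y (suc i) = extInf (λ i → κ (suc i)) B (λ j → y (suc j)) i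
extInf κ (false ∷ B) y zero = nothing
extInf κ (false ∷ B) y (suc i) = extInf (λ i → κ (suc i)) B y i

extInf-def : ∀ {N} (κ : Fin N → Set) (B : SubsetN N) (y : (j : Fin (card B)) → κ (enum B j))
  (i : Fin N) → T (lookup B i) → IsFin (extInf κ B y i)
extInf-def κ (true ∷ B) y zero p = tt
extInf-def κ (true ∷ B) y (suc i) p = extInf-def (λ i → κ (suc i)) B (λ j → y (suc j)) i p
extInf-def κ (false ∷ B) y (suc i) p = extInf-def (λ i → κ (suc i)) B y i p

yInf : ∀ {N} (κ : Fin N → Set) (B : SubsetN N) → ((j : Fin (card B)) → κ (enum B j)) → D κ B
yInf κ B y = pt[ extInf κ B y , extInf-def κ B y ]

{-# OPTIONS --safe #-}
-- If f = d g then f_B(y^∞) = Σ_{i ∈ B} g_{B∖{i}}(y^∞). Padding a point of ∏_{i ∈ B} α(κ_i)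
-- with ∞ off B is continuous and maps 𝒟_{B∖{i}}(κ|_B) into 𝒟_{B∖{i}}(κ), so the composites
-- of the g_{B∖{i}} with it lie in 𝒞_{B∖{i}}(κ|_B) and exhibit y ↦ f_B(y^∞) as a top coboundary.
module Submission where

open import Defs
open import Data.Nat using (ℕ; zero; suc; _<_)
open import Data.Fin using (Fin; _≤_; zero; suc)
open import Data.Product using (proj₁; _,_)
open import Data.Bool using (Bool; true; false; _xor_; _∧_; T)
open import Data.Maybe using (Maybe; just; nothing)
open import Data.List using (List)
open import Data.Unit using (tt)
open import Data.Vec using (_∷_; []; lookup)
open import Function.Base using (_∘_)
open import Function.Bundles using (_↣_)
open import Relation.Binary.PropositionalEquality
  using (_≡_; _≗_; refl; sym; trans; cong; cong₂; subst; module ≡-Reasoning)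

⨁-cong : ∀ {N} {f g : Fin N → Bool} → f ≗ g → ⨁ f ≡ ⨁ g
⨁-cong {zero} f≗g = refl
⨁-cong {suc N} f≗g = cong₂ _xor_ (f≗g zero) (⨁-cong (f≗g ∘ suc))

⨁-∧-enum : ∀ {N} (B : SubsetN N) (h : Fin N → Bool) →
  ⨁ (λ i → lookup B i ∧ h i) ≡ ⨁ (h ∘ enum B)
⨁-∧-enum [] h = refl
⨁-∧-enum (true ∷ B) h = cong (h zero xor_) (⨁-∧-enum B (h ∘ suc))
⨁-∧-enum (false ∷ B) h = ⨁-∧-enum B (h ∘ suc)

mutual
  dcob≡⨁∧ : ∀ {N} {κ : Fin N → Set} (g : (A : SubsetN N) → C κ A) (A : SubsetN N) (x : D κ A) →
    dcob g A x ≡ ⨁ (λ i → lookup A i ∧ proj₁ (g (del A i)) (restrict A i x))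
  dcob≡⨁∧ g A x = ⨁-cong (dcob-summand≡∧ g A x)

  -- dcob selects its summands by a function local to Defs that cannot be named here, so the
  -- left-hand side is supplied by unification with the use above. Abstracting the bit alone
  -- would make the with-abstraction ill-typed, so the summand is abstracted first.
  dcob-summand≡∧ : ∀ {N} {κ : Fin N → Set} (g : (A : SubsetN N) → C κ A) (A : SubsetN N) (x : D κ A)
    (i : Fin N) → _ ≡ lookup A i ∧ proj₁ (g (del A i)) (restrict A i x)
  dcob-summand≡∧ g A x i with proj₁ (g (del A i)) (restrict A i x) | lookup A i
  ... | _ | true = refl
  ... | _ | false = refl

dcob≡⨁-enum : ∀ {N} {κ : Fin N → Set} (g : (A : SubsetN N) → C κ A) (B : SubsetN N) (x : D κ B) →
  dcob g B x ≡ ⨁ (λ j → proj₁ (g (del B (enum B j))) (restrict B (enum B j) x))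
dcob≡⨁-enum g B x =
  trans (dcob≡⨁∧ g B x) (⨁-∧-enum B (λ i → proj₁ (g (del B i)) (restrict B i x)))

NearC-refl : ∀ {S : Set} (a : Maybe S) (L : List S) → NearC a L a
NearC-refl (just a) L = refl
NearC-refl nothing L = tt

-- Without function extensionality, pointwise equal points are identified through
-- continuity: each lies in every basic neighbourhood of the other.
C-cong : ∀ {N} {κ : Fin N → Set} {A : SubsetN N} (φ : C κ A) (x y : D κ A) →
  (∀ i → pt x i ≡ pt y i) → proj₁ φ x ≡ proj₁ φ y
C-cong (φ , φ-cont) x y x≗y =
  let (L , near⇒≡) = φ-cont y
  in near⇒≡ x (λ i → subst (NearC (pt y i) (L i)) (sym (x≗y i)) (NearC-refl (pt y i) (L i)))

image : ∀ {N} (B : SubsetN N) → SubsetN (card B) → SubsetN N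
image [] [] = []
image (true ∷ B) (a ∷ A) = a ∷ image B A
image (false ∷ B) A = false ∷ image B A

image-full : ∀ {N} (B : SubsetN N) → image B (full (card B)) ≡ B
image-full [] = refl
image-full (true ∷ B) = cong (true ∷_) (image-full B)
image-full (false ∷ B) = cong (false ∷_) (image-full B)

del-image : ∀ {N} (B : SubsetN N) (A : SubsetN (card B)) (j : Fin (card B)) →
  del (image B A) (enum B j) ≡ image B (del A j)
del-image (true ∷ B) (a ∷ A) zero = refl
del-image (true ∷ B) (a ∷ A) (suc j) = cong (a ∷_) (del-image B A j)
del-image (false ∷ B) A j = cong (false ∷_) (del-image B A j)

del-enum : ∀ {N} (B : SubsetN N) (j : Fin (card B)) →
  del B (enum B j) ≡ image B (del (full (card B)) j)
del-enum B j = begin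
  del B (enum B j)                         ≡⟨ cong (λ A → del A (enum B j)) (sym (image-full B)) ⟩
  del (image B (full (card B))) (enum B j) ≡⟨ del-image B (full (card B)) j ⟩
  image B (del (full (card B)) j)          ∎
  where open ≡-Reasoning

pad∞ : ∀ {N} (κ : Fin N → Set) (B : SubsetN N) → X (restrictTuple κ B) → X κ
pad∞ κ (true ∷ B) z zero = z zero
pad∞ κ (true ∷ B) z (suc i) = pad∞ (κ ∘ suc) B (z ∘ suc) i
pad∞ κ (false ∷ B) z zero = nothing
pad∞ κ (false ∷ B) z (suc i) = pad∞ (κ ∘ suc) B z i

extInf≡pad∞ : ∀ {N} (κ : Fin N → Set) (B : SubsetN N) (y : (j : Fin (card B)) → κ (enum B j)) →
  ∀ i → extInf κ B y i ≡ pad∞ κ B (just ∘ y) i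
extInf≡pad∞ κ (true ∷ B) y zero = refl
extInf≡pad∞ κ (true ∷ B) y (suc i) = extInf≡pad∞ (κ ∘ suc) B (y ∘ suc) i
extInf≡pad∞ κ (false ∷ B) y zero = refl
extInf≡pad∞ κ (false ∷ B) y (suc i) = extInf≡pad∞ (κ ∘ suc) B y i

pad∞-isFin : ∀ {N} (κ : Fin N → Set) (B : SubsetN N) (A : SubsetN (card B)) (z : X (restrictTuple κ B)) →
  ((j : Fin (card B)) → T (lookup A j) → IsFin (z j)) →
  (i : Fin N) → T (lookup (image B A) i) → IsFin (pad∞ κ B z i)
pad∞-isFin κ (true ∷ B) (a ∷ A) z fin zero a∈A = fin zero a∈A
pad∞-isFin κ (true ∷ B) (a ∷ A) z fin (suc i) =
  pad∞-isFin (κ ∘ suc) B A (z ∘ suc) (fin ∘ suc) i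
pad∞-isFin κ (false ∷ B) A z fin (suc i) = pad∞-isFin (κ ∘ suc) B A z fin i

pad∞-near : ∀ {N} (κ : Fin N → Set) (B : SubsetN N) (L : (i : Fin N) → List (κ i))
  (z w : X (restrictTuple κ B)) → Near z (L ∘ enum B) w → Near (pad∞ κ B z) L (pad∞ κ B w)
pad∞-near κ (true ∷ B) L z w near zero = near zero
pad∞-near κ (true ∷ B) L z w near (suc i) =
  pad∞-near (κ ∘ suc) B (L ∘ suc) (z ∘ suc) (w ∘ suc) (near ∘ suc) i
pad∞-near κ (false ∷ B) L z w near zero = tt
pad∞-near κ (false ∷ B) L z w near (suc i) = pad∞-near (κ ∘ suc) B (L ∘ suc) z w near i

module _ {N} (κ : Fin N → Set) (B : SubsetN N) {A : SubsetN N} {A₀ : SubsetN (card B)}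
         (A≡ : A ≡ image B A₀) where

  pad∞-D : D (restrictTuple κ B) A₀ → D κ A
  pad∞-D pt[ z , z-fin ] =
    pt[ pad∞ κ B z , (λ i i∈A → pad∞-isFin κ B A₀ z z-fin i (subst (λ A → T (lookup A i)) A≡ i∈A)) ]

  pullback-pad∞ : C κ A → C (restrictTuple κ B) A₀
  pullback-pad∞ (φ , φ-cont) = φ ∘ pad∞-D , continuous
    where
    continuous : Continuous (restrictTuple κ B) A₀ (φ ∘ pad∞-D)
    continuous x =
      let (L , near⇒≡) = φ-cont (pad∞-D x)
      in L ∘ enum B , λ y near → near⇒≡ (pad∞-D y) (pad∞-near κ B L (pt x) (pt y) near)

proposition5p2 : (k n : ℕ) → 0 < k → k < n →
    (κ : Fin (suc n) → Set) → ((i j : Fin (suc n)) → i ≤ j → κ i ↣ κ j) →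
    (B : SubsetN (suc n)) (hB : card B ≡ suc k) →
    (f : (A : SubsetN (suc n)) → card A ≡ suc k → C κ A) →
    IsCoboundary κ k f →
    IsTopCoboundary (restrictTuple κ B) (λ y → proj₁ (f B hB) (yInf κ B y))
proposition5p2 k n _ _ κ _ B hB f (g , f≡dg) = G , λ y → begin
  proj₁ (f B hB) (yInf κ B y)
    ≡⟨ f≡dg B hB (yInf κ B y) ⟩
  dcob g B (yInf κ B y)
    ≡⟨ dcob≡⨁-enum g B (yInf κ B y) ⟩
  ⨁ (λ j → proj₁ (g (del B (enum B j))) (restrict B (enum B j) (yInf κ B y)))
    ≡⟨ ⨁-cong (λ j → C-cong (g (del B (enum B j))) _ _ (extInf≡pad∞ κ B y)) ⟩
  ⨁ (λ j → proj₁ (G j) (restrict (full (card B)) j (embed y)))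
    ∎
  where
  open ≡-Reasoning
  G : (j : Fin (card B)) → C (restrictTuple κ B) (del (full (card B)) j)
  G j = pullback-pad∞ κ B (del-enum B j) (g (del B (enum B j)))
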